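{- Under the standing hypotheses described in the context, let $\gamma$ be a plane of $\mathrm{PG}(2k,q)$ containing four distinct points $P_1,P_2,P_3,P_4$ of $\mathcal{Q}$ such that the point $P_1P_2\cap P_3P_4$ does not belong to $\mathcal{Q}\cup D$. Then $\gamma$ meets $H_\infty$ in a line containing exactly $q-1$ points of $D$.
   Context: Standing hypotheses: $q=2^h$ with $h\ge4$, $k\ge2$; $H_\infty\cong\mathrm{PG}(2k-1,q)$ is a hyperplane of $\mathrm{PG}(2k,q)$, points outside $H_\infty$ are affine; for distinct affine points $P,R$ the point $PR\cap H_\infty$ is the direction they determine. $\mathcal{Q}$ is a set of $q^k$ affine points, $D\subseteq H_\infty$ is the set of directions determined by pairs of distinct points of $\mathcal{Q}$, $|D|=q^k-1$, and every line of $\mathrm{PG}(2k,q)$ meets $D$ in $0$, $1$, $3$ or $q-1$ points. -}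

module Defs where

open import Level using (Level; _⊔_)
open import Algebra.Bundles using (CommutativeRing)
open import Data.Nat using (ℕ; suc)
open import Data.Fin using (Fin)
import Data.Fin as Fin
open import Data.Product using (Σ; ∃; ∃₂; _×_)
open import Relation.Nullary using (¬_)
open import Relation.Binary.PropositionalEquality using (_≡_; _≢_)

record IsField {c ℓ} (R : CommutativeRing c ℓ) : Set (c ⊔ ℓ) where
  open CommutativeRing R hiding (zero)
  field
    0≉1     : ¬ (0# ≈ 1#)
    inverse : ∀ x → ¬ (x ≈ 0#) → Σ Carrier λ y → x * y ≈ 1#

HasOrder : ∀ {c ℓ} (R : CommutativeRing c ℓ) → ℕ → Set (c ⊔ ℓ)
HasOrder R q = Σ (Fin q → Carrier) λ e →
                 (∀ i j → e i ≈ e j → i ≡ j) × (∀ x → ∃ λ i → x ≈ e i)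
  where open CommutativeRing R

-- The projective space PG(n, F) in homogeneous coordinates x₀,…,xₙ.
-- The hyperplane at infinity H∞ is x₀ = 0.
module Projective {c ℓ} (R : CommutativeRing c ℓ) (n : ℕ) where
  open CommutativeRing R hiding (zero)

  Vector : Set c
  Vector = Fin (suc n) → Carrier

  IsZero : Vector → Set ℓ
  IsZero v = ∀ i → v i ≈ 0#

  -- a point is represented by a nonzero vector; points are equal iff proportional
  Point : Set (c ⊔ ℓ)
  Point = Σ Vector λ v → ¬ IsZero v

  vec : Point → Vector
  vec = Data.Product.proj₁

  _≐_ : Point → Point → Set (c ⊔ ℓ)
  X ≐ Y = ∃ λ a → ∀ i → vec X i ≈ a * vec Y i

  OnLine : Point → Point → Point → Set (c ⊔ ℓ)
  OnLine A B X = ∃₂ λ a b → ∀ i → vec X i ≈ a * vec A i + b * vec B i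

  OnPlane : Point → Point → Point → Point → Set (c ⊔ ℓ)
  OnPlane A B C X = ∃₂ λ a b → ∃ λ d →
    ∀ i → vec X i ≈ a * vec A i + b * vec B i + d * vec C i

  Indep2 : Point → Point → Set (c ⊔ ℓ)
  Indep2 A B = ∀ a b → (∀ i → a * vec A i + b * vec B i ≈ 0#) → (a ≈ 0#) × (b ≈ 0#)

  Indep3 : Point → Point → Point → Set (c ⊔ ℓ)
  Indep3 A B C = ∀ a b d → (∀ i → a * vec A i + b * vec B i + d * vec C i ≈ 0#)
                   → (a ≈ 0#) × (b ≈ 0#) × (d ≈ 0#)

  InH∞ : Point → Set ℓ
  InH∞ X = vec X Fin.zero ≈ 0#

  Affine : Point → Set ℓ
  Affine X = ¬ InH∞ X

  HasCard : (Point → Set (c ⊔ ℓ)) → ℕ → Set (c ⊔ ℓ)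
  HasCard S m = Σ (Fin m → Point) λ f →
    (∀ i → S (f i)) × (∀ i j → f i ≐ f j → i ≡ j) × (∀ X → S X → ∃ λ i → X ≐ f i)

  InQ : {N : ℕ} → (Fin N → Point) → Point → Set (c ⊔ ℓ)
  InQ Q X = ∃ λ i → X ≐ Q i

  InD : {N : ℕ} → (Fin N → Point) → Point → Set (c ⊔ ℓ)
  InD Q X = InH∞ X × ∃₂ λ i j → i ≢ j × OnLine (Q i) (Q j) X

module Submission where

-- Since X is the only common point of P₁P₂ and P₃P₄ and X ∉ 𝒬 ∪ D, the directions of
-- P₁P₂, P₁P₃, P₁P₄, P₃P₄ are four distinct points of D on the line γ ∩ H∞; as a line
-- meets D in 0, 1, 3 or q − 1 points, it meets it in q − 1.

open import Algebra.Bundles using (CommutativeRing; RawRing)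
open import Algebra.Solver.Ring.AlmostCommutativeRing
  using (fromCommutativeRing; _-Raw-AlmostCommutative⟶_)
import Algebra.Solver.Ring
import Algebra.Solver.CommutativeMonoid as CommutativeMonoidSolver
open import Data.Nat as ℕ using (ℕ; zero; suc; s≤s)
import Data.Nat.Properties as ℕₚ
open import Data.Fin as Fin using (Fin)
open import Data.Fin.Properties using (pigeonhole)
open import Data.Fin.Patterns using (0F; 1F; 2F; 3F)
open import Data.Product using (Σ; ∃₂; _×_; _,_; proj₁; proj₂)
open import Data.Product.Properties using (≡-dec)
open import Data.Maybe using (Maybe; just; nothing)
open import Data.Vec using ([]; _∷_)
open import Data.Empty using (⊥-elim)
open import Data.Sum using (_⊎_; inj₁; inj₂)
open import Relation.Nullary using (¬_; Dec; yes; no)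
open import Relation.Binary.PropositionalEquality as ≡ using (_≡_; _≢_)
open import Function.Bundles using (_⇔_; mk⇔; Equivalence)
open import Level using (_⊔_)
open import Defs

module RingSolver {c ℓ} (R : CommutativeRing c ℓ) where
  open CommutativeRing R hiding (zero)
  import Algebra.Properties.Semiring.Mult semiring as Mult
  open Mult using (×-homo-+; ×1-homo-*)
  open import Algebra.Properties.AbelianGroup +-abelianGroup using (⁻¹-anti-homo‿-; ⁻¹-∙-comm)
  open import Algebra.Properties.Ring ring using (-‿distribˡ-*; -‿distribʳ-*; -0#≈0#)
  open import Relation.Binary.Reasoning.Setoid setoid

  ι : ℕ → Carrier
  ι n = n Mult.× 1#

  interchange : ∀ x y z w → (x - y) + (z - w) ≈ (x + z) - (y + w)
  interchange x y z w = begin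
    (x + - y) + (z + - w) ≈⟨ prove 4 ((a ⊕ b) ⊕ (d ⊕ e)) ((a ⊕ d) ⊕ (b ⊕ e)) (x ∷ - y ∷ z ∷ - w ∷ []) ⟩
    (x + z) + (- y + - w) ≈⟨ +-congˡ (⁻¹-∙-comm y w) ⟩
    (x + z) - (y + w)     ∎
    where
    open CommutativeMonoidSolver +-commutativeMonoid using (prove; var; _⊕_)
    a = var (Fin.# 0); b = var (Fin.# 1); d = var (Fin.# 2); e = var (Fin.# 3)

  cancelˡ : ∀ x y z → (x + y) - (x + z) ≈ y - z
  cancelˡ x y z = begin
    (x + y) - (x + z) ≈⟨ interchange x x y z ⟨
    (x - x) + (y - z) ≈⟨ +-congʳ (-‿inverseʳ x) ⟩
    0# + (y - z)      ≈⟨ +-identityˡ _ ⟩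
    y - z             ∎

  difference-* : ∀ a b d e → (a - b) * (d - e) ≈ (a * d + b * e) - (a * e + b * d)
  difference-* a b d e = begin
    (a - b) * (d - e)                 ≈⟨ trans (distribʳ _ a (- b)) (+-congˡ (sym (-‿distribˡ-* b _))) ⟩
    a * (d - e) - b * (d - e)         ≈⟨ +-cong (distrib-- a) (-‿cong (distrib-- b)) ⟩
    (a * d - a * e) - (b * d - b * e) ≈⟨ +-congˡ (⁻¹-anti-homo‿- _ _) ⟩
    (a * d - a * e) + (b * e - b * d) ≈⟨ interchange _ _ _ _ ⟩
    (a * d + b * e) - (a * e + b * d) ∎
    where
    distrib-- : ∀ x → x * (d - e) ≈ x * d - x * e
    distrib-- x = trans (distribˡ x d (- e)) (+-congˡ (sym (-‿distribʳ-* x e)))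

  -- Coefficients: the integer a − b as the pair (a , b), kept reduced (a = 0 or b = 0)
  -- so that equal integers are equal pairs and coefficient equality is decidable.
  Difference : Set
  Difference = Σ ℕ λ _ → ℕ

  reduce : ℕ → ℕ → Difference
  reduce (suc a) (suc b) = reduce a b
  reduce a       b       = a , b

  ⟦_⟧ : Difference → Carrier
  ⟦ a , b ⟧ = ι a - ι b

  reduce-sound : ∀ a b → ⟦ reduce a b ⟧ ≈ ι a - ι b
  reduce-sound zero    b       = refl
  reduce-sound (suc a) zero    = refl
  reduce-sound (suc a) (suc b) = trans (reduce-sound a b) (sym (cancelˡ 1# (ι a) (ι b)))

  differences : RawRing _ _
  differences = record
    { Carrier = Difference
    ; _≈_     = _≡_
    ; _+_     = λ (a , b) (d , e) → reduce (a ℕ.+ d) (b ℕ.+ e)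
    ; _*_     = λ (a , b) (d , e) → reduce (a ℕ.* d ℕ.+ b ℕ.* e) (a ℕ.* e ℕ.+ b ℕ.* d)
    ; -_      = λ (a , b) → b , a
    ; 0#      = 0 , 0
    ; 1#      = 1 , 0
    }

  ⟦⟧-homomorphism : differences -Raw-AlmostCommutative⟶ fromCommutativeRing R
  ⟦⟧-homomorphism = record
    { ⟦_⟧    = ⟦_⟧
    ; +-homo = λ (a , b) (d , e) → begin
        ⟦ reduce (a ℕ.+ d) (b ℕ.+ e) ⟧ ≈⟨ reduce-sound (a ℕ.+ d) (b ℕ.+ e) ⟩
        ι (a ℕ.+ d) - ι (b ℕ.+ e)      ≈⟨ +-cong (×-homo-+ 1# a d) (-‿cong (×-homo-+ 1# b e)) ⟩
        (ι a + ι d) - (ι b + ι e)      ≈⟨ interchange _ _ _ _ ⟨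
        ⟦ a , b ⟧ + ⟦ d , e ⟧          ∎
    ; *-homo = λ (a , b) (d , e) → begin
        ⟦ reduce (a ℕ.* d ℕ.+ b ℕ.* e) (a ℕ.* e ℕ.+ b ℕ.* d) ⟧
          ≈⟨ reduce-sound (a ℕ.* d ℕ.+ b ℕ.* e) (a ℕ.* e ℕ.+ b ℕ.* d) ⟩
        ι (a ℕ.* d ℕ.+ b ℕ.* e) - ι (a ℕ.* e ℕ.+ b ℕ.* d)
          ≈⟨ +-cong (ι-+-* a d b e) (-‿cong (ι-+-* a e b d)) ⟩
        (ι a * ι d + ι b * ι e) - (ι a * ι e + ι b * ι d)
          ≈⟨ difference-* _ _ _ _ ⟨
        ⟦ a , b ⟧ * ⟦ d , e ⟧ ∎
    ; -‿homo = λ (a , b) → sym (⁻¹-anti-homo‿- (ι a) (ι b))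
    ; 0-homo = -‿inverseʳ 0#
    ; 1-homo = trans (+-congˡ -0#≈0#) (trans (+-identityʳ _) (+-identityʳ 1#))
    }
    where
    ι-+-* : ∀ a d b e → ι (a ℕ.* d ℕ.+ b ℕ.* e) ≈ ι a * ι d + ι b * ι e
    ι-+-* a d b e = trans (×-homo-+ 1# (a ℕ.* d) (b ℕ.* e)) (+-cong (×1-homo-* a d) (×1-homo-* b e))

  coefficients≟ : ∀ p q → Maybe (⟦ p ⟧ ≈ ⟦ q ⟧)
  coefficients≟ p q with ≡-dec ℕₚ._≟_ ℕₚ._≟_ p q
  ... | yes ≡.refl = just refl
  ... | no _       = nothing

  open Algebra.Solver.Ring differences (fromCommutativeRing R) ⟦⟧-homomorphism coefficients≟ public
    using (solve; _:=_; _:+_; _:*_; _:-_; :-_)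

decidableEquality : ∀ {c ℓ} (R : CommutativeRing c ℓ) {q : ℕ} → HasOrder R q →
  let open CommutativeRing R in ∀ x y → Dec (x ≈ y)
decidableEquality R (e , e-injective , e-onto) x y with e-onto x | e-onto y
... | i , x≈eᵢ | j , y≈eⱼ with i Fin.≟ j
...   | yes ≡.refl = yes (trans x≈eᵢ (sym y≈eⱼ))
  where open CommutativeRing R
...   | no i≢j     = no λ x≈y → i≢j (e-injective i j (trans (sym x≈eᵢ) (trans x≈y y≈eⱼ)))
  where open CommutativeRing R

module Geometry {c ℓ} (R : CommutativeRing c ℓ) (isField : IsField R)
  (≈0? : ∀ x → Dec (CommutativeRing._≈_ R x (CommutativeRing.0# R))) (n : ℕ) where
  open CommutativeRing R hiding (zero)
  open IsField isField
  open Projective R n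
  open RingSolver R
  open import Relation.Binary.Reasoning.Setoid setoid

  x₀ : Fin (suc n)
  x₀ = Fin.zero

  _⁻¹⟨_⟩ : ∀ x → ¬ x ≈ 0# → Carrier
  x ⁻¹⟨ x≉0 ⟩ = proj₁ (inverse x x≉0)

  ⁻¹-cancel : ∀ {x} (x≉0 : ¬ x ≈ 0#) y → x ⁻¹⟨ x≉0 ⟩ * (x * y) ≈ y
  ⁻¹-cancel {x} x≉0 y = begin
    x ⁻¹⟨ x≉0 ⟩ * (x * y) ≈⟨ *-assoc _ x y ⟨
    (x ⁻¹⟨ x≉0 ⟩ * x) * y ≈⟨ *-congʳ (trans (*-comm _ x) (proj₂ (inverse x x≉0))) ⟩
    1# * y                ≈⟨ *-identityˡ y ⟩
    y                     ∎

  no-zero-divisors : ∀ {x y} → ¬ x ≈ 0# → x * y ≈ 0# → y ≈ 0#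
  no-zero-divisors {x} {y} x≉0 xy≈0 =
    trans (sym (⁻¹-cancel x≉0 y)) (trans (*-congˡ xy≈0) (zeroʳ _))

  *-zeroˡ : ∀ {x} y → x ≈ 0# → x * y ≈ 0#
  *-zeroˡ y x≈0 = trans (*-congʳ x≈0) (zeroˡ y)

  ≐-scaled : ∀ {X W κ a} → ¬ κ ≈ 0# → (∀ i → κ * vec X i ≈ a * vec W i) → X ≐ W
  ≐-scaled {X} {W} {κ} {a} κ≉0 h = κ ⁻¹⟨ κ≉0 ⟩ * a , λ i → begin
    vec X i                      ≈⟨ ⁻¹-cancel κ≉0 _ ⟨
    κ ⁻¹⟨ κ≉0 ⟩ * (κ * vec X i)  ≈⟨ *-congˡ (h i) ⟩
    κ ⁻¹⟨ κ≉0 ⟩ * (a * vec W i)  ≈⟨ *-assoc _ a _ ⟨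
    (κ ⁻¹⟨ κ≉0 ⟩ * a) * vec W i  ∎

  -- ≐ is symmetric and transitive (scalars relating nonzero vectors are nonzero)
  ≐-sym : ∀ {X Y} → X ≐ Y → Y ≐ X
  ≐-sym {X} {Y} (a , h) = ≐-scaled {Y} {X} {a = 1#} a≉0 λ i → trans (sym (h i)) (sym (*-identityˡ _))
    where
    a≉0 : ¬ a ≈ 0#
    a≉0 a≈0 = proj₂ X λ i → trans (h i) (*-zeroˡ _ a≈0)

  ≐-trans : ∀ {X Y Z} → X ≐ Y → Y ≐ Z → X ≐ Z
  ≐-trans (a , hXY) (b , hYZ) = a * b , λ i →
    trans (hXY i) (trans (*-congˡ (hYZ i)) (sym (*-assoc a b _)))

  affine≉infinite : ∀ {X W} → Affine X → InH∞ W → ¬ X ≐ W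
  affine≉infinite X∉H W∈H (a , h) = X∉H (trans (h x₀) (trans (*-congˡ W∈H) (zeroʳ a)))

  onLine-scaled : ∀ {A B Z κ a b} → ¬ κ ≈ 0# →
    (∀ i → κ * vec Z i ≈ a * vec A i + b * vec B i) → OnLine A B Z
  onLine-scaled {A} {B} {Z} {κ} {a} {b} κ≉0 h = κ⁻¹ * a , κ⁻¹ * b , λ i → begin
    vec Z i                             ≈⟨ ⁻¹-cancel κ≉0 _ ⟨
    κ⁻¹ * (κ * vec Z i)                 ≈⟨ *-congˡ (h i) ⟩
    κ⁻¹ * (a * vec A i + b * vec B i)   ≈⟨ solve 5 (λ k a x b y → k :* (a :* x :+ b :* y) := (k :* a) :* x :+ (k :* b) :* y)
                                             refl κ⁻¹ a (vec A i) b (vec B i) ⟩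
    (κ⁻¹ * a) * vec A i + (κ⁻¹ * b) * vec B i ∎
    where κ⁻¹ = κ ⁻¹⟨ κ≉0 ⟩

  onLine-left : ∀ {A B} → OnLine A B A
  onLine-left = 1# , 0# , λ i → sym (trans (+-cong (*-identityˡ _) (zeroˡ _)) (+-identityʳ _))

  onLine-right : ∀ {A B} → OnLine A B B
  onLine-right = 0# , 1# , λ i → sym (trans (+-cong (zeroˡ _) (*-identityˡ _)) (+-identityˡ _))

  onLine-swap : ∀ {A B Y} → OnLine A B Y → OnLine B A Y
  onLine-swap (a , b , h) = b , a , λ i → trans (h i) (+-comm _ _)

  onLine-≐ : ∀ {A B Y Z} → Y ≐ Z → OnLine A B Z → OnLine A B Y
  onLine-≐ {A} {B} {Y} {Z} (l , hYZ) (a , b , hZ) = l * a , l * b , λ i → begin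
    vec Y i                      ≈⟨ hYZ i ⟩
    l * vec Z i                  ≈⟨ *-congˡ (hZ i) ⟩
    l * (a * vec A i + b * vec B i) ≈⟨ solve 5 (λ l a x b y → l :* (a :* x :+ b :* y) := (l :* a) :* x :+ (l :* b) :* y)
                                       refl l a (vec A i) b (vec B i) ⟩
    (l * a) * vec A i + (l * b) * vec B i ∎

  onLine-trans : ∀ {A B X W Y} → OnLine X W Y → OnLine A B X → OnLine A B W → OnLine A B Y
  onLine-trans {A} {B} {X} {W} {Y} (α , β , hY) (a , b , hX) (d , e , hW) =
    α * a + β * d , α * b + β * e , λ i → begin
      vec Y i                                           ≈⟨ hY i ⟩
      α * vec X i + β * vec W i                         ≈⟨ +-cong (*-congˡ (hX i)) (*-congˡ (hW i)) ⟩
      α * (a * vec A i + b * vec B i) + β * (d * vec A i + e * vec B i)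
        ≈⟨ solve 8 (λ α β a b d e x y → α :* (a :* x :+ b :* y) :+ β :* (d :* x :+ e :* y)
                       := (α :* a :+ β :* d) :* x :+ (α :* b :+ β :* e) :* y)
                refl α β a b d e (vec A i) (vec B i) ⟩
      (α * a + β * d) * vec A i + (α * b + β * e) * vec B i ∎

  balance : ∀ {p q r s} → p * q + (- r) * s ≈ 0# → p * q ≈ r * s
  balance {p} {q} {r} {s} h = begin
    p * q                           ≈⟨ solve 4 (λ p q r s → p :* q := (p :* q :+ (:- r) :* s) :+ r :* s) refl p q r s ⟩
    (p * q + (- r) * s) + r * s     ≈⟨ +-congʳ h ⟩
    0# + r * s                      ≈⟨ +-identityˡ _ ⟩
    r * s                           ∎

  -- With X = aC + bD and W = eC + fD and Δ = af − be one has Δ·C = f·X − b·W and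
  -- Δ·D = a·W − e·X; if Δ = 0 these relations make X and W proportional.
  exchange : ∀ {C D X W} → ¬ X ≐ W → OnLine C D X → OnLine C D W → OnLine X W C × OnLine X W D
  exchange {C} {D} {X} {W} X≉W (a , b , hX) (e , f , hW) = byCases (≈0? Δ)
    where
    Δ : Carrier
    Δ = a * f - b * e

    relC : ∀ i → Δ * vec C i ≈ f * vec X i + (- b) * vec W i
    relC i = trans
      (solve 6 (λ a b e f x y → (a :* f :- b :* e) :* x := f :* (a :* x :+ b :* y) :+ (:- b) :* (e :* x :+ f :* y))
             refl a b e f (vec C i) (vec D i))
      (+-cong (*-congˡ (sym (hX i))) (*-congˡ (sym (hW i))))

    relD : ∀ i → Δ * vec D i ≈ a * vec W i + (- e) * vec X i
    relD i = trans
      (solve 6 (λ a b e f x y → (a :* f :- b :* e) :* y := a :* (e :* x :+ f :* y) :+ (:- e) :* (a :* x :+ b :* y))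
             refl a b e f (vec C i) (vec D i))
      (+-cong (*-congˡ (sym (hW i))) (*-congˡ (sym (hX i))))

    proportional : Δ ≈ 0# → X ≐ W
    proportional Δ≈0 with ≈0? f
    ... | no f≉0  = ≐-scaled {X} {W} f≉0 λ i → balance (trans (sym (relC i)) (*-zeroˡ _ Δ≈0))
    ... | yes f≈0 = ≐-scaled {X} {W} e≉0 λ i → sym (balance (trans (sym (relD i)) (*-zeroˡ _ Δ≈0)))
      where
      e≉0 : ¬ e ≈ 0#
      e≉0 e≈0 = proj₂ W λ i → trans (hW i) (trans (+-cong (*-zeroˡ _ e≈0) (*-zeroˡ _ f≈0)) (+-identityʳ 0#))

    byCases : Dec (Δ ≈ 0#) → OnLine X W C × OnLine X W D
    byCases (no Δ≉0)  = onLine-scaled {X} {W} {C} Δ≉0 relC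
                      , onLine-scaled {X} {W} {D} Δ≉0 (λ i → trans (relD i) (+-comm _ _))
    byCases (yes Δ≈0) = ⊥-elim (X≉W (proportional Δ≈0))

  meetOnce : ∀ {A B C D X W} → ¬ (OnLine A B C × OnLine A B D) →
    OnLine A B X → OnLine C D X → OnLine A B W → OnLine C D W → ¬ ¬ X ≐ W
  meetOnce {A} {B} {C} {D} {X} {W} notBoth X∈AB X∈CD W∈AB W∈CD X≉W =
    notBoth (onLine-trans {A} {B} {X} {W} {C} C∈XW X∈AB W∈AB , onLine-trans {A} {B} {X} {W} {D} D∈XW X∈AB W∈AB)
    where
    C∈XW : OnLine X W C
    C∈XW = proj₁ (exchange {C} {D} {X} {W} X≉W X∈CD W∈CD)
    D∈XW : OnLine X W D
    D∈XW = proj₂ (exchange {C} {D} {X} {W} X≉W X∈CD W∈CD)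

  commonDirection : ∀ {P R S W} → Affine P → InH∞ W → OnLine P S W → OnLine P R W → OnLine P R S
  commonDirection {P} {R} {S} {W} P∉H W∈H W∈PS W∈PR =
    onLine-trans {P} {R} {P} {W} {S} S∈PW (onLine-left {P} {R}) W∈PR
    where
    S∈PW : OnLine P W S
    S∈PW = proj₂ (exchange {P} {S} {P} {W} (affine≉infinite {P} {W} P∉H W∈H) (onLine-left {P} {S}) W∈PS)

  -- U₀·V − V₀·U: for distinct U, V this is the point where the line UV meets H∞.
  toInfinity : Point → Point → Vector
  toInfinity U V i = vec U x₀ * vec V i - vec V x₀ * vec U i

  toInfinity-atInfinity : ∀ U V → toInfinity U V x₀ ≈ 0#
  toInfinity-atInfinity U V = trans (+-congˡ (-‿cong (*-comm _ _))) (-‿inverseʳ _)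

  toInfinity-onLine : ∀ U V i → toInfinity U V i ≈ (- vec V x₀) * vec U i + vec U x₀ * vec V i
  toInfinity-onLine U V i =
    solve 4 (λ u₀ v₀ u v → u₀ :* v :- v₀ :* u := (:- v₀) :* u :+ u₀ :* v) refl (vec U x₀) (vec V x₀) (vec U i) (vec V i)

  toInfinity-zero : ∀ {U V} → Affine U → IsZero (toInfinity U V) → V ≐ U
  toInfinity-zero {U} {V} U∉H vanishes = ≐-scaled {V} {U} U∉H λ i → x∙y⁻¹≈ε⇒x≈y _ _ (vanishes i)
    where open import Algebra.Properties.Group +-group using (x∙y⁻¹≈ε⇒x≈y)

  onPlane-line : ∀ {A B C X W Y} → OnPlane A B C X → OnPlane A B C W → OnLine X W Y → OnPlane A B C Y
  onPlane-line {A} {B} {C} {X} {W} {Y} (a , b , d , hX) (a′ , b′ , d′ , hW) (α , β , hY) =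
    α * a + β * a′ , α * b + β * b′ , α * d + β * d′ , λ i → begin
      vec Y i                   ≈⟨ hY i ⟩
      α * vec X i + β * vec W i ≈⟨ +-cong (*-congˡ (hX i)) (*-congˡ (hW i)) ⟩
      α * (a * vec A i + b * vec B i + d * vec C i) + β * (a′ * vec A i + b′ * vec B i + d′ * vec C i)
        ≈⟨ solve 11 (λ α β a b d a′ b′ d′ x y z →
                 α :* (a :* x :+ b :* y :+ d :* z) :+ β :* (a′ :* x :+ b′ :* y :+ d′ :* z)
              := (α :* a :+ β :* a′) :* x :+ (α :* b :+ β :* b′) :* y :+ (α :* d :+ β :* d′) :* z)
              refl α β a b d a′ b′ d′ (vec A i) (vec B i) (vec C i) ⟩
      (α * a + β * a′) * vec A i + (α * b + β * b′) * vec B i + (α * d + β * d′) * vec C i ∎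

  LineAtInfinity : Point → Point → Point → Set (c ⊔ ℓ)
  LineAtInfinity A B C = ∃₂ λ E F → InH∞ E × InH∞ F × Indep2 E F ×
    (∀ Y → (OnPlane A B C Y × InH∞ Y) ⇔ OnLine E F Y)

  -- If the spanning point C is affine, the plane ABC meets H∞ in the line through the
  -- points E = C₀A − A₀C and F = C₀B − B₀C where the lines CA and CB meet H∞.
  module Pivot (A B C : Point) (indep : Indep3 A B C) (C∉H : Affine C) where
    κ : Carrier
    κ = vec C x₀

    expand : ∀ a b i → a * toInfinity C A i + b * toInfinity C B i
                       ≈ (a * κ) * vec A i + (b * κ) * vec B i + (- (a * vec A x₀ + b * vec B x₀)) * vec C i
    expand a b i = solve 8 (λ a b k a₀ b₀ x y z →
        a :* (k :* x :- a₀ :* z) :+ b :* (k :* y :- b₀ :* z)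
      := (a :* k) :* x :+ (b :* k) :* y :+ (:- (a :* a₀ :+ b :* b₀)) :* z)
      refl a b κ (vec A x₀) (vec B x₀) (vec A i) (vec B i) (vec C i)

    independent : ∀ a b → (∀ i → a * toInfinity C A i + b * toInfinity C B i ≈ 0#) → a ≈ 0# × b ≈ 0#
    independent a b h = cancelκ (proj₁ r) , cancelκ (proj₁ (proj₂ r))
      where
      r = indep (a * κ) (b * κ) _ λ i → trans (sym (expand a b i)) (h i)
      cancelκ : ∀ {x} → x * κ ≈ 0# → x ≈ 0#
      cancelκ xκ≈0 = no-zero-divisors C∉H (trans (*-comm _ _) xκ≈0)

    E F : Point
    E = toInfinity C A , λ vanishes → 0≉1 (sym (proj₁ (independent 1# 0# λ i →
          trans (+-cong (trans (*-identityˡ _) (vanishes i)) (zeroˡ _)) (+-identityʳ 0#))))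
    F = toInfinity C B , λ vanishes → 0≉1 (sym (proj₂ (independent 0# 1# λ i →
          trans (+-cong (zeroˡ _) (trans (*-identityˡ _) (vanishes i))) (+-identityʳ 0#))))

    -- Y = aA + bB + dC at infinity gives κ·Y = a·E + b·F, since dκ = −(aA₀ + bB₀).
    toLine : ∀ Y → OnPlane A B C Y × InH∞ Y → OnLine E F Y
    toLine Y ((a , b , d , hY) , Y∈H) = onLine-scaled {E} {F} {Y} C∉H λ i → begin
      κ * vec Y i                                        ≈⟨ *-congˡ (hY i) ⟩
      κ * (a * vec A i + b * vec B i + d * vec C i)
        ≈⟨ solve 9 (λ k a b d a₀ b₀ x y z →
                 k :* (a :* x :+ b :* y :+ d :* z)
              := a :* (k :* x :- a₀ :* z) :+ b :* (k :* y :- b₀ :* z) :+ (a :* a₀ :+ b :* b₀ :+ d :* k) :* z)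
              refl κ a b d (vec A x₀) (vec B x₀) (vec A i) (vec B i) (vec C i) ⟩
      a * vec E i + b * vec F i + (a * vec A x₀ + b * vec B x₀ + d * κ) * vec C i
        ≈⟨ +-congˡ (*-zeroˡ _ (trans (sym (hY x₀)) Y∈H)) ⟩
      a * vec E i + b * vec F i + 0#                     ≈⟨ +-identityʳ _ ⟩
      a * vec E i + b * vec F i                          ∎

    fromLine : ∀ Y → OnLine E F Y → OnPlane A B C Y × InH∞ Y
    fromLine Y (α , β , hY) = (α * κ , β * κ , _ , λ i → trans (hY i) (expand α β i))
      , trans (hY x₀) (trans (+-cong (*-congˡ (toInfinity-atInfinity C A)) (*-congˡ (toInfinity-atInfinity C B)))
                      (trans (+-cong (zeroʳ α) (zeroʳ β)) (+-identityʳ 0#)))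

    lineAtInfinity : LineAtInfinity A B C
    lineAtInfinity = E , F , toInfinity-atInfinity C A , toInfinity-atInfinity C B , independent
                   , λ Y → mk⇔ (toLine Y) (fromLine Y)

  onPlane-rotate : ∀ {A B C Y} → OnPlane A B C Y → OnPlane B C A Y
  onPlane-rotate {A} {B} {C} (a , b , d , h) = b , d , a , λ i → trans (h i)
    (solve 6 (λ a b d x y z → a :* x :+ b :* y :+ d :* z := b :* y :+ d :* z :+ a :* x)
           refl a b d (vec A i) (vec B i) (vec C i))

  indep-rotate : ∀ {A B C} → Indep3 A B C → Indep3 B C A
  indep-rotate {A} {B} {C} indep a b d h = proj₁ (proj₂ r) , proj₂ (proj₂ r) , proj₁ r
    where
    r = indep d a b λ i → trans
      (solve 6 (λ a b d x y z → d :* x :+ a :* y :+ b :* z := a :* y :+ b :* z :+ d :* x)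
             refl a b d (vec A i) (vec B i) (vec C i))
      (h i)

  lineAtInfinity-rotate : ∀ {A B C} → LineAtInfinity B C A → LineAtInfinity A B C
  lineAtInfinity-rotate {A} {B} {C} (E , F , E∈H , F∈H , indepEF , section) =
    E , F , E∈H , F∈H , indepEF , λ Y → mk⇔
      (λ (Y∈ABC , Y∈H) → Equivalence.to (section Y) (onPlane-rotate {A} {B} {C} {Y} Y∈ABC , Y∈H))
      (λ Y∈EF → let (Y∈BCA , Y∈H) = Equivalence.from (section Y) Y∈EF
                in onPlane-rotate {C} {A} {B} {Y} (onPlane-rotate {B} {C} {A} {Y} Y∈BCA) , Y∈H)

  -- A plane through an affine point P meets H∞ in a line: one of A, B, C is affine
  -- and serves as pivot, after rotating it into the last position.
  lineAtInfinity : ∀ {A B C P} → Indep3 A B C → OnPlane A B C P → Affine P → LineAtInfinity A B C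
  lineAtInfinity {A} {B} {C} {P} indep (a , b , d , hP) P∉H
    with ≈0? (vec C x₀) | ≈0? (vec A x₀) | ≈0? (vec B x₀)
  ... | no C∉H | _      | _      = Pivot.lineAtInfinity A B C indep C∉H
  ... | yes _  | no A∉H | _      =
    lineAtInfinity-rotate {A} {B} {C} (Pivot.lineAtInfinity B C A (indep-rotate {A} {B} {C} indep) A∉H)
  ... | yes _  | yes _  | no B∉H =
    lineAtInfinity-rotate {A} {B} {C} (lineAtInfinity-rotate {B} {C} {A}
      (Pivot.lineAtInfinity C A B (indep-rotate {B} {C} {A} (indep-rotate {A} {B} {C} indep)) B∉H))
  ... | yes C∈H | yes A∈H | yes B∈H = ⊥-elim (P∉H (trans (hP x₀)
    (trans (+-cong (+-cong (trans (*-congˡ A∈H) (zeroʳ a)) (trans (*-congˡ B∈H) (zeroʳ b))) (trans (*-congˡ C∈H) (zeroʳ d)))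
           (trans (+-identityʳ _) (+-identityʳ 0#)))))

  atLeast : ∀ {S : Point → Set (c ⊔ ℓ)} {m k} → HasCard S m → (Y : Fin k → Point) → (∀ i → S (Y i)) →
    (∀ i j → i Fin.< j → ¬ Y i ≐ Y j) → k ℕ.≤ m
  atLeast {S} (f , _ , _ , cover) Y Y∈S distinct = ℕₚ.≮⇒≥ λ m<k →
    let (i , j , i<j , same) = pigeonhole m<k index in
    distinct i j i<j (≐-trans {Y i} {f (index i)} {Y j} (representative i)
      (≐-sym {Y j} {f (index i)} (≡.subst (λ t → Y j ≐ f t) (≡.sym same) (representative j))))
    where
    index : _ → Fin _
    index i = proj₁ (cover (Y i) (Y∈S i))
    representative : ∀ i → Y i ≐ f (index i)
    representative i = proj₂ (cover (Y i) (Y∈S i))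

  module PointSet {N : ℕ} (Q : Fin N → Point) (Q-affine : ∀ i → Affine (Q i))
                  (Q-injective : ∀ i j → Q i ≐ Q j → i ≡ j) where

    LineOfD : Point → Point → Point → ℕ → Set (c ⊔ ℓ)
    LineOfD A B C size = ∃₂ λ E F → InH∞ E × InH∞ F × Indep2 E F ×
      (∀ Y → (OnPlane A B C Y × InH∞ Y) ⇔ OnLine E F Y) × HasCard (λ Y → InD Q Y × OnLine E F Y) size

    direction : ∀ i j → i ≢ j → Point
    direction i j i≢j = toInfinity (Q i) (Q j) , λ vanishes →
      i≢j (≡.sym (Q-injective j i (toInfinity-zero {Q i} {Q j} (Q-affine i) vanishes)))

    direction-onLine : ∀ i j i≢j → OnLine (Q i) (Q j) (direction i j i≢j)
    direction-onLine i j _ = _ , _ , toInfinity-onLine (Q i) (Q j)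

    direction-inD : ∀ i j i≢j → InD Q (direction i j i≢j)
    direction-inD i j i≢j = toInfinity-atInfinity (Q i) (Q j) , i , j , i≢j , direction-onLine i j i≢j

    direction-onPlane : ∀ {A B C} i j i≢j → OnPlane A B C (Q i) → OnPlane A B C (Q j) →
      OnPlane A B C (direction i j i≢j)
    direction-onPlane {A} {B} {C} i j i≢j Qi∈ABC Qj∈ABC =
      onPlane-line {A} {B} {C} {Q i} {Q j} {direction i j i≢j} Qi∈ABC Qj∈ABC (direction-onLine i j i≢j)

    module FourPoints (p₁ p₂ p₃ p₄ : Fin N)
      (p₁≢p₂ : p₁ ≢ p₂) (p₁≢p₃ : p₁ ≢ p₃) (p₁≢p₄ : p₁ ≢ p₄) (p₃≢p₄ : p₃ ≢ p₄)
      (notCollinear : ¬ (OnLine (Q p₁) (Q p₂) (Q p₃) × OnLine (Q p₁) (Q p₂) (Q p₄)))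
      (X : Point) (X∈P₁P₂ : OnLine (Q p₁) (Q p₂) X) (X∈P₃P₄ : OnLine (Q p₃) (Q p₄) X)
      (X∉Q : ¬ InQ Q X) (X∉H : Affine X) where

      P₁ P₂ P₃ P₄ : Point
      P₁ = Q p₁
      P₂ = Q p₂
      P₃ = Q p₃
      P₄ = Q p₄

      onlyX : ∀ {W} → OnLine P₁ P₂ W → OnLine P₃ P₄ W → ¬ ¬ X ≐ W
      onlyX {W} = meetOnce {P₁} {P₂} {P₃} {P₄} {X} {W} notCollinear X∈P₁P₂ X∈P₃P₄

      P₃∉P₁P₂ : ¬ OnLine P₁ P₂ P₃
      P₃∉P₁P₂ P₃∈P₁P₂ = onlyX {P₃} P₃∈P₁P₂ (onLine-left {P₃} {P₄}) λ X≐P₃ → X∉Q (p₃ , X≐P₃)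

      P₄∉P₁P₂ : ¬ OnLine P₁ P₂ P₄
      P₄∉P₁P₂ P₄∈P₁P₂ = onlyX {P₄} P₄∈P₁P₂ (onLine-right {P₃} {P₄}) λ X≐P₄ → X∉Q (p₄ , X≐P₄)

      P₁∉P₃P₄ : ¬ OnLine P₃ P₄ P₁
      P₁∉P₃P₄ P₁∈P₃P₄ = onlyX {P₁} (onLine-left {P₁} {P₂}) P₁∈P₃P₄ λ X≐P₁ → X∉Q (p₁ , X≐P₁)

      noCommonPointAtInfinity : ∀ {W} → InH∞ W → OnLine P₁ P₂ W → ¬ OnLine P₃ P₄ W
      noCommonPointAtInfinity {W} W∈H W∈P₁P₂ W∈P₃P₄ = onlyX {W} W∈P₁P₂ W∈P₃P₄ (affine≉infinite {X} {W} X∉H W∈H)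

      d₁₂ d₁₃ d₁₄ d₃₄ : Point
      d₁₂ = direction p₁ p₂ p₁≢p₂
      d₁₃ = direction p₁ p₃ p₁≢p₃
      d₁₄ = direction p₁ p₄ p₁≢p₄
      d₃₄ = direction p₃ p₄ p₃≢p₄

      onLineOf : ∀ {W} i j i≢j → W ≐ direction i j i≢j → OnLine (Q i) (Q j) W
      onLineOf {W} i j i≢j W≐d = onLine-≐ {Q i} {Q j} {W} {direction i j i≢j} W≐d (direction-onLine i j i≢j)

      d₁₂≉d₁₃ : ¬ d₁₂ ≐ d₁₃
      d₁₂≉d₁₃ e = P₃∉P₁P₂ (commonDirection {P₁} {P₂} {P₃} {d₁₂} (Q-affine p₁)
        (toInfinity-atInfinity P₁ P₂) (onLineOf {d₁₂} p₁ p₃ p₁≢p₃ e) (direction-onLine p₁ p₂ p₁≢p₂))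

      d₁₂≉d₁₄ : ¬ d₁₂ ≐ d₁₄
      d₁₂≉d₁₄ e = P₄∉P₁P₂ (commonDirection {P₁} {P₂} {P₄} {d₁₂} (Q-affine p₁)
        (toInfinity-atInfinity P₁ P₂) (onLineOf {d₁₂} p₁ p₄ p₁≢p₄ e) (direction-onLine p₁ p₂ p₁≢p₂))

      d₁₂≉d₃₄ : ¬ d₁₂ ≐ d₃₄
      d₁₂≉d₃₄ e = noCommonPointAtInfinity {d₁₂} (toInfinity-atInfinity P₁ P₂)
        (direction-onLine p₁ p₂ p₁≢p₂) (onLineOf {d₁₂} p₃ p₄ p₃≢p₄ e)

      -- P₄ on P₁P₃ would put P₁ on P₃P₄, by exchange in the line P₁P₃
      d₁₃≉d₁₄ : ¬ d₁₃ ≐ d₁₄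
      d₁₃≉d₁₄ e = P₁∉P₃P₄ (proj₁ (exchange {P₁} {P₃} {P₃} {P₄} P₃≉P₄ (onLine-right {P₁} {P₃}) P₄∈P₁P₃))
        where
        P₃≉P₄ : ¬ P₃ ≐ P₄
        P₃≉P₄ P₃≐P₄ = p₃≢p₄ (Q-injective p₃ p₄ P₃≐P₄)
        P₄∈P₁P₃ : OnLine P₁ P₃ P₄
        P₄∈P₁P₃ = commonDirection {P₁} {P₃} {P₄} {d₁₃} (Q-affine p₁)
          (toInfinity-atInfinity P₁ P₃) (onLineOf {d₁₃} p₁ p₄ p₁≢p₄ e) (direction-onLine p₁ p₃ p₁≢p₃)

      d₁₃≉d₃₄ : ¬ d₁₃ ≐ d₃₄
      d₁₃≉d₃₄ e = P₁∉P₃P₄ (commonDirection {P₃} {P₄} {P₁} {d₁₃} (Q-affine p₃)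
        (toInfinity-atInfinity P₁ P₃) (onLine-swap {P₁} {P₃} {d₁₃} (direction-onLine p₁ p₃ p₁≢p₃))
        (onLineOf {d₁₃} p₃ p₄ p₃≢p₄ e))

      d₁₄≉d₃₄ : ¬ d₁₄ ≐ d₃₄
      d₁₄≉d₃₄ e = P₁∉P₃P₄ (onLine-swap {P₄} {P₃} {P₁} (commonDirection {P₄} {P₃} {P₁} {d₁₄} (Q-affine p₄)
        (toInfinity-atInfinity P₁ P₄) (onLine-swap {P₁} {P₄} {d₁₄} (direction-onLine p₁ p₄ p₁≢p₄))
        (onLine-swap {P₃} {P₄} {d₁₄} (onLineOf {d₁₄} p₃ p₄ p₃≢p₄ e))))

      directions : Fin 4 → Point
      directions 0F = d₁₂
      directions 1F = d₁₃
      directions 2F = d₁₄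
      directions 3F = d₃₄

      directions-distinct : ∀ i j → i Fin.< j → ¬ directions i ≐ directions j
      directions-distinct 0F 1F _ = d₁₂≉d₁₃
      directions-distinct 0F 2F _ = d₁₂≉d₁₄
      directions-distinct 0F 3F _ = d₁₂≉d₃₄
      directions-distinct 1F 2F _ = d₁₃≉d₁₄
      directions-distinct 1F 3F _ = d₁₃≉d₃₄
      directions-distinct 2F 3F _ = d₁₄≉d₃₄
      directions-distinct _  0F ()
      directions-distinct 1F 1F (s≤s ())
      directions-distinct 2F 1F (s≤s ())
      directions-distinct 3F 1F (s≤s ())
      directions-distinct 2F 2F (s≤s (s≤s ()))
      directions-distinct 3F 2F (s≤s (s≤s ()))
      directions-distinct 3F 3F (s≤s (s≤s (s≤s ())))

      directions-inD : ∀ i → InD Q (directions i)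
      directions-inD 0F = direction-inD p₁ p₂ p₁≢p₂
      directions-inD 1F = direction-inD p₁ p₃ p₁≢p₃
      directions-inD 2F = direction-inD p₁ p₄ p₁≢p₄
      directions-inD 3F = direction-inD p₃ p₄ p₃≢p₄

      directions-onPlane : ∀ {A B C} → OnPlane A B C P₁ → OnPlane A B C P₂ → OnPlane A B C P₃ →
        OnPlane A B C P₄ → ∀ i → OnPlane A B C (directions i)
      directions-onPlane {A} {B} {C} P₁∈γ P₂∈γ P₃∈γ P₄∈γ 0F = direction-onPlane {A} {B} {C} p₁ p₂ p₁≢p₂ P₁∈γ P₂∈γ
      directions-onPlane {A} {B} {C} P₁∈γ P₂∈γ P₃∈γ P₄∈γ 1F = direction-onPlane {A} {B} {C} p₁ p₃ p₁≢p₃ P₁∈γ P₃∈γ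
      directions-onPlane {A} {B} {C} P₁∈γ P₂∈γ P₃∈γ P₄∈γ 2F = direction-onPlane {A} {B} {C} p₁ p₄ p₁≢p₄ P₁∈γ P₄∈γ
      directions-onPlane {A} {B} {C} P₁∈γ P₂∈γ P₃∈γ P₄∈γ 3F = direction-onPlane {A} {B} {C} p₃ p₄ p₃≢p₄ P₃∈γ P₄∈γ

onlyFull : ∀ {m full} → (m ≡ 0 ⊎ m ≡ 1 ⊎ m ≡ 3 ⊎ m ≡ full) → 4 ℕ.≤ m → m ≡ full
onlyFull (inj₁ ≡.refl)                ()
onlyFull (inj₂ (inj₁ ≡.refl))         (s≤s ())
onlyFull (inj₂ (inj₂ (inj₁ ≡.refl)))  (s≤s (s≤s (s≤s ())))
onlyFull (inj₂ (inj₂ (inj₂ m≡full))) _ = m≡full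

-- The vocabulary of the statement; imported only here because Data.Nat's _*_ would
-- clash with the ring multiplication in the modules above.
open import Defs
open import Algebra.Bundles using (CommutativeRing)
open import Data.Nat using (ℕ; _≤_; _^_; _*_; _∸_)
open import Data.Fin using (Fin)
open import Data.Product using (Σ; ∃; ∃₂; _×_)
open import Data.Sum using (_⊎_)
open import Relation.Nullary using (¬_)
open import Relation.Binary.PropositionalEquality using (_≡_; _≢_)
open import Function.Bundles using (_⇔_)

-- The plane γ = ABC meets H∞ in a line EF (γ contains the affine point P₁). The four
-- directions P₁P₂, P₁P₃, P₁P₄, P₃P₄ are distinct points of D on EF, so EF is not one of
-- the lines with 0, 1 or 3 points of D: it has q − 1 of them.
lemma3p3 : ∀ {c ℓ} (R : CommutativeRing c ℓ) → IsField R →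
    (h k : ℕ) → 4 ≤ h → 2 ≤ k → HasOrder R (2 ^ h) →
    let open Projective R (2 * k) in
    (Q : Fin ((2 ^ h) ^ k) → Point) →
    (∀ i → Affine (Q i)) →
    (∀ i j → Q i ≐ Q j → i ≡ j) →
    HasCard (InD Q) ((2 ^ h) ^ k ∸ 1) →
    (∀ A B → Indep2 A B → ∃ λ m → HasCard (λ X → InD Q X × OnLine A B X) m ×
        (m ≡ 0 ⊎ m ≡ 1 ⊎ m ≡ 3 ⊎ m ≡ 2 ^ h ∸ 1)) →
    (A B C : Point) → Indep3 A B C →
    (p₁ p₂ p₃ p₄ : Fin ((2 ^ h) ^ k)) →
    p₁ ≢ p₂ → p₁ ≢ p₃ → p₁ ≢ p₄ → p₂ ≢ p₃ → p₂ ≢ p₄ → p₃ ≢ p₄ →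
    OnPlane A B C (Q p₁) → OnPlane A B C (Q p₂) →
    OnPlane A B C (Q p₃) → OnPlane A B C (Q p₄) →
    ¬ (OnLine (Q p₁) (Q p₂) (Q p₃) × OnLine (Q p₁) (Q p₂) (Q p₄)) →
    (X : Point) → OnLine (Q p₁) (Q p₂) X → OnLine (Q p₃) (Q p₄) X →
    ¬ InQ Q X → ¬ InD Q X →
    ∃₂ λ E F → InH∞ E × InH∞ F × Indep2 E F ×
      (∀ Y → (OnPlane A B C Y × InH∞ Y) ⇔ OnLine E F Y) ×
      HasCard (λ Y → InD Q Y × OnLine E F Y) (2 ^ h ∸ 1)
lemma3p3 R isField h k _ _ order Q Q-affine Q-injective _ lineCount A B C indep
         p₁ p₂ p₃ p₄ p₁≢p₂ p₁≢p₃ p₁≢p₄ _ _ p₃≢p₄ P₁∈γ P₂∈γ P₃∈γ P₄∈γ notCollinear X X∈P₁P₂ X∈P₃P₄ X∉Q X∉D =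
  fullLine (lineAtInfinity {A} {B} {C} {Q p₁} indep P₁∈γ (Q-affine p₁))
  where
  open Projective R (2 * k)
  open Geometry R isField (λ x → decidableEquality R order x _) (2 * k)
  open PointSet Q Q-affine Q-injective
  -- X is affine: a point at infinity on P₁P₂ would be in D
  open FourPoints p₁ p₂ p₃ p₄ p₁≢p₂ p₁≢p₃ p₁≢p₄ p₃≢p₄ notCollinear X X∈P₁P₂ X∈P₃P₄ X∉Q
    (λ X∈H → X∉D (X∈H , p₁ , p₂ , p₁≢p₂ , X∈P₁P₂))

  fullLine : LineAtInfinity A B C → LineOfD A B C (2 ^ h ∸ 1)
  fullLine (E , F , E∈H , F∈H , E≠F , section) with lineCount E F E≠F
  ... | m , count , admissible = E , F , E∈H , F∈H , E≠F , section ,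
    ≡.subst (HasCard _) (onlyFull admissible (atLeast count directions onEF directions-distinct)) count
    where
    onEF : ∀ i → InD Q (directions i) × OnLine E F (directions i)
    onEF i = directions-inD i , Equivalence.to (section (directions i))
      (directions-onPlane {A} {B} {C} P₁∈γ P₂∈γ P₃∈γ P₄∈γ i , proj₁ (directions-inD i))
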